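{- Let $\mathcal{H}=\mathbb{Q}\langle Y\rangle$, $Y=\{z_k:k\in\mathbb{Z}\}$, be the quasi-shuffle Hopf algebra (quasi-shuffle product $\ast$, deconcatenation coproduct, counit $\varepsilon$), let $N$ be the linear span of non-singular words, let $\mathcal{N}$ be the two-sided ideal generated by $N$ (a Hopf ideal), and let $\mathcal{A}$ be a nonzero commutative unital $\mathbb{Q}$-algebra. Let $\mathfrak{t}_{\mathcal{A}}$ be the Lie algebra of the renormalisation group $T_{\mathcal{A}}$, i.e. the space of $\mathcal{A}$-valued infinitesimal characters of $\mathcal{H}/\mathcal{N}$: linear maps $\delta:\mathcal{H}/\mathcal{N}\to\mathcal{A}$ with $\delta(xy)=\delta(x)\varepsilon(y)+\varepsilon(x)\delta(y)$. Then $\mathfrak{t}_{\mathcal{A}}$ is infinite-dimensional.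
   Context: The quasi-shuffle product: $\mathbf{1}\ast v=v\ast\mathbf{1}=v$, $z_mv\ast z_nw=z_m(v\ast z_nw)+z_n(z_mv\ast w)+z_{m+n}(v\ast w)$. Coproduct: $\Delta(w)=\sum_{uv=w}u\otimes v$; $\varepsilon(\mathbf{1})=1$, $\varepsilon(w)=0$ otherwise. A word $z_{k_1}\cdots z_{k_n}$ is non-singular if $k_1\neq1$, $k_1+k_2\notin\{2,1,0,-2,-4,\ldots\}$ and $k_1+\cdots+k_j\notin\mathbb{Z}_{\le j}$ for $3\le j\le n$. $T_{\mathcal{A}}$ is the group (under convolution) of unital algebra morphisms $(\mathcal{H},\ast)\to\mathcal{A}$ vanishing on $N$, equivalently the $\mathcal{A}$-valued characters of $\mathcal{H}/\mathcal{N}$. -}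

module Defs where

open import Level using (Level; _⊔_; suc)
open import Data.Nat as ℕ using (ℕ)
open import Data.Integer as ℤ using (ℤ; +_)
open import Data.Rational as ℚ using (ℚ)
open import Data.List using (List; []; _∷_; map; _++_; concatMap)
open import Data.Product using (Σ; _×_; _,_)
open import Data.Fin using (Fin)
open import Data.Unit using (⊤)
open import Data.Empty using (⊥)
open import Data.Sum using (_⊎_)
open import Relation.Nullary using (¬_)
open import Relation.Binary.PropositionalEquality using (_≡_; _≢_)
open import Algebra.Bundles using (CommutativeRing)
open import Algebra.Morphism.Structures using (IsRingHomomorphism)

-- Words over the alphabet Y = { z_k : k ∈ ℤ }; the letter z_k is k.

Word : Set
Word = List ℤ

-- Elements of H = ℚ⟨Y⟩ as finite formal ℚ-linear combinations of words.
H : Set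
H = List (ℚ × Word)

⟪_⟫ : Word → H
⟪ w ⟫ = (ℚ.1ℚ , w) ∷ []

qsh : Word → Word → List Word
qsh [] w = w ∷ []
qsh (m ∷ v) [] = (m ∷ v) ∷ []
qsh (m ∷ v) (n ∷ w) =
  map (m ∷_) (qsh v (n ∷ w)) ++
  map (n ∷_) (qsh (m ∷ v) w) ++
  map ((m ℤ.+ n) ∷_) (qsh v w)

_∗_ : H → H → H
x ∗ y = concatMap (λ { (p , v) →
          concatMap (λ { (q , w) → map (λ u → (p ℚ.* q , u)) (qsh v w) }) y }) x

Bad₂ : ℤ → Set
Bad₂ s = (s ≡ + 2) ⊎ (s ≡ + 1) ⊎ ((s ℤ.≤ + 0) × Σ ℤ (λ t → s ≡ t ℤ.+ t))

-- conditions k₁+⋯+k_j ∉ ℤ_{≤ j} for j ≥ 3; s is the partial sum so far,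
-- j the index of the next letter
condJ : ℕ → ℤ → Word → Set
condJ j s [] = ⊤
condJ j s (k ∷ ks) = ¬ ((s ℤ.+ k) ℤ.≤ + j) × condJ (ℕ.suc j) (s ℤ.+ k) ks

cond₂ : ℤ → Word → Set
cond₂ k₁ [] = ⊤
cond₂ k₁ (k₂ ∷ ks) = ¬ Bad₂ (k₁ ℤ.+ k₂) × condJ 3 (k₁ ℤ.+ k₂) ks

NonSingular : Word → Set
NonSingular [] = ⊥
NonSingular (k₁ ∷ ks) = (k₁ ≢ + 1) × cond₂ k₁ ks

record QAlgebra (c ℓ : Level) : Set (suc (c ⊔ ℓ)) where
  field
    commRing : CommutativeRing c ℓ
  open CommutativeRing commRing public
  field
    ι      : ℚ → Carrier
    ι-hom  : IsRingHomomorphism ℚ.+-*-rawRing rawRing ι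

module _ {c ℓ} (A : QAlgebra c ℓ) where
  open QAlgebra A

  lin : (Word → Carrier) → H → Carrier
  lin f [] = 0#
  lin f ((q , w) ∷ x) = (ι q * f w) + lin f x

  εw : Word → Carrier
  εw [] = 1#
  εw (_ ∷ _) = 0#

  ε : H → Carrier
  ε = lin εw

  -- the linear map determined by f vanishes on the two-sided ideal 𝒩
  -- generated by N = span of non-singular words (spanned by x ∗ n ∗ y)
  VanishesOn𝒩 : (Word → Carrier) → Set ℓ
  VanishesOn𝒩 f = ∀ (x y : H) (n : Word) → NonSingular n →
                   lin f ((x ∗ ⟪ n ⟫) ∗ y) ≈ 0#

  IsInfChar : (Word → Carrier) → Set ℓ
  IsInfChar f = VanishesOn𝒩 f ×
    (∀ (x y : H) → lin f (x ∗ y) ≈ (lin f x * ε y) + (ε x * lin f y))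

  𝔱 : Set (c ⊔ ℓ)
  𝔱 = Σ (Word → Carrier) IsInfChar

  ∑ : (n : ℕ) → (Fin n → Carrier) → Carrier
  ∑ ℕ.zero g = 0#
  ∑ (ℕ.suc n) g = g Fin.zero + ∑ n (λ i → g (Fin.suc i))
    where import Data.Fin as Fin

  LinIndep : (n : ℕ) → (Fin n → 𝔱) → Set (c ⊔ ℓ)
  LinIndep n δ = ∀ (a : Fin n → Carrier) →
    (∀ (w : Word) → ∑ n (λ i → a i * Σ.proj₁ (δ i) w) ≈ 0#) →
    ∀ i → a i ≈ 0#
    where import Data.Product as Σ

  InfiniteDimensional : Set (c ⊔ ℓ)
  InfiniteDimensional = ∀ (n : ℕ) → Σ (Fin n → 𝔱) (LinIndep n)

  Nonzero : Set ℓ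
  Nonzero = ¬ (1# ≈ 0#)

{-# OPTIONS --safe #-}
module Submission where

-- The product ∗ is homogeneous for the weight
-- k₁ + ⋯ + kₙ of z_{k₁}⋯z_{kₙ}, so every weight component of a derivation is again a
-- derivation, and a non-singular word never has weight 1; hence weight-1 derivations
-- are infinitesimal characters. Derivations are closed under the convolution bracket
-- because Δ is multiplicative. Starting from the derivation L(z_{k₁}⋯z_{kₙ}) = (-1)ⁿ kₙ
-- and writing L_s for its weight-s component, the weight-1 components δ_k of
-- [L, L_{-(k+1)}] satisfy δ_k(z_{j+2} z_{-(j+1)}) = -(j+2)(j+1) if k = j and 0 otherwise.
-- These values are units of A, so δ₀, δ₁, … are linearly independent.

open import Defs
open import Level using (Level)
open import Function using (_∘_)
open import Data.Nat as ℕ using (ℕ)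
import Data.Nat.Properties as ℕP
open import Data.Fin using (Fin; toℕ)
import Data.Fin as Fin
import Data.Fin.Properties as FinP
open import Data.Integer as ℤ using (ℤ; +_; -[1+_])
import Data.Integer.Properties as ℤP
open import Data.Integer.Solver using (module +-*-Solver)
open import Data.Rational as ℚ using (ℚ)
open import Data.Rational.Literals using (fromℤ)
import Data.Rational.Properties as ℚP
import Data.Rational.Unnormalised as ℚᵘ
import Data.Rational.Unnormalised.Properties as ℚᵘP
open import Data.List using (List; []; _∷_; map; _++_; concatMap)
open import Data.List.Relation.Unary.All as All using (All; []; _∷_)
import Data.List.Relation.Unary.All.Properties as AllP
open import Data.Product using (Σ; _×_; _,_)
open import Data.Sum using (inj₁; inj₂)
open import Relation.Nullary using (¬_; yes; no)
open import Relation.Nullary.Negation using (contradiction)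
open import Relation.Binary.PropositionalEquality as P using (_≡_; _≢_)
open import Algebra.Bundles using (CommutativeMonoid)
open import Algebra.Morphism.Structures using (IsRingHomomorphism)
open import Algebra.Solver.Ring.AlmostCommutativeRing using (fromCommutativeRing; _-Raw-AlmostCommutative⟶_)
import Algebra.Solver.Ring as RingSolver
import Data.Maybe as Maybe
open import Relation.Nullary.Decidable using (dec⇒maybe)

-- Weights and non-singular words

weight : Word → ℤ
weight [] = + 0
weight (k ∷ x) = k ℤ.+ weight x

prefix-weight : ∀ k {s t} us → k ℤ.+ s ≡ t →
                All (λ u → weight u ≡ s) us → All (λ u → weight u ≡ t) (map (k ∷_) us)
prefix-weight k us k+s≡t ws = AllP.map⁺ (All.map (λ e → P.trans (P.cong (λ z → k ℤ.+ z) e) k+s≡t) ws)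

qsh-weight : ∀ v w → All (λ u → weight u ≡ weight v ℤ.+ weight w) (qsh v w)
qsh-weight [] w = P.sym (ℤP.+-identityˡ (weight w)) ∷ []
qsh-weight (m ∷ v) [] = P.sym (ℤP.+-identityʳ (weight (m ∷ v))) ∷ []
qsh-weight (m ∷ v) (n ∷ w) =
  AllP.++⁺ (prefix-weight m (qsh v (n ∷ w)) (eq₁ m n (weight v) (weight w)) (qsh-weight v (n ∷ w)))
  (AllP.++⁺ (prefix-weight n (qsh (m ∷ v) w) (eq₂ m n (weight v) (weight w)) (qsh-weight (m ∷ v) w))
            (prefix-weight (m ℤ.+ n) (qsh v w) (eq₃ m n (weight v) (weight w)) (qsh-weight v w)))
  where
  open +-*-Solver
  eq₁ : ∀ m n a b → m ℤ.+ (a ℤ.+ (n ℤ.+ b)) ≡ (m ℤ.+ a) ℤ.+ (n ℤ.+ b)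
  eq₁ = solve 4 (λ m n a b → m :+ (a :+ (n :+ b)) := (m :+ a) :+ (n :+ b)) P.refl
  eq₂ : ∀ m n a b → n ℤ.+ ((m ℤ.+ a) ℤ.+ b) ≡ (m ℤ.+ a) ℤ.+ (n ℤ.+ b)
  eq₂ = solve 4 (λ m n a b → n :+ ((m :+ a) :+ b) := (m :+ a) :+ (n :+ b)) P.refl
  eq₃ : ∀ m n a b → (m ℤ.+ n) ℤ.+ (a ℤ.+ b) ≡ (m ℤ.+ a) ℤ.+ (n ℤ.+ b)
  eq₃ = solve 4 (λ m n a b → (m :+ n) :+ (a :+ b) := (m :+ a) :+ (n :+ b)) P.refl

qsh-[]ʳ : ∀ v → qsh v [] ≡ v ∷ []
qsh-[]ʳ [] = P.refl
qsh-[]ʳ (_ ∷ _) = P.refl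

condJ⇒weight> : ∀ j s k ks → condJ j s (k ∷ ks) → ¬ (s ℤ.+ weight (k ∷ ks) ℤ.≤ + j)
condJ⇒weight> j s k [] (s+k≰j , _) rewrite ℤP.+-identityʳ k = s+k≰j
condJ⇒weight> j s k (k′ ∷ ks) (_ , rest) s+w≤j =
  condJ⇒weight> (ℕ.suc j) (s ℤ.+ k) k′ ks rest
    (ℤP.≤-trans (ℤP.≤-reflexive (ℤP.+-assoc s k (weight (k′ ∷ ks))))
                (ℤP.≤-trans s+w≤j (ℤ.+≤+ (ℕP.n≤1+n j))))

nonSingular⇒weight≢1 : ∀ n → NonSingular n → weight n ≢ + 1
nonSingular⇒weight≢1 (k ∷ []) (k≢1 , _) e = k≢1 (P.trans (P.sym (ℤP.+-identityʳ k)) e)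
nonSingular⇒weight≢1 (k₁ ∷ k₂ ∷ []) (_ , ¬bad , _) e =
  ¬bad (inj₂ (inj₁ (P.trans (P.cong (λ z → k₁ ℤ.+ z) (P.sym (ℤP.+-identityʳ k₂))) e)))
nonSingular⇒weight≢1 (k₁ ∷ k₂ ∷ k ∷ ks) (_ , _ , rest) e =
  condJ⇒weight> 3 (k₁ ℤ.+ k₂) k ks rest
    (ℤP.≤-trans (ℤP.≤-reflexive (P.trans (ℤP.+-assoc k₁ k₂ _) e)) (ℤ.+≤+ (ℕ.s≤s ℕ.z≤n)))

probe : ℕ → Word
probe j = + ℕ.suc (ℕ.suc j) ∷ -[1+ j ] ∷ []

weight-probe : ∀ j → weight (probe j) ≡ + 1
weight-probe j = eq (+ ℕ.suc j)
  where
  open +-*-Solver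
  eq : ∀ x → (+ 1 ℤ.+ x) ℤ.+ (ℤ.- x ℤ.+ + 0) ≡ + 1
  eq = solve 1 (λ x → (con (+ 1) :+ x) :+ (:- x :+ con (+ 0)) := con (+ 1)) P.refl

fromℤ-homo-+ : ∀ m n → fromℤ (m ℤ.+ n) ≡ fromℤ m ℚ.+ fromℤ n
fromℤ-homo-+ m n = ℚP.toℚᵘ-injective
  (ℚᵘP.≃-trans (ℚᵘ.*≡* cross) (ℚᵘP.≃-sym (ℚP.toℚᵘ-homo-+ (fromℤ m) (fromℤ n))))
  where
  open +-*-Solver
  cross : (m ℤ.+ n) ℤ.* + 1 ≡ (m ℤ.* + 1 ℤ.+ n ℤ.* + 1) ℤ.* + 1
  cross = solve 2 (λ m n → (m :+ n) :* con (+ 1) := (m :* con (+ 1) :+ n :* con (+ 1)) :* con (+ 1)) P.refl m n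

-- Sums over lists of words and over deconcatenations

module WordSums {c ℓ} (M : CommutativeMonoid c ℓ) where
  open CommutativeMonoid M renaming (_∙_ to _+_; ε to 0#)
  open import Relation.Binary.Reasoning.Setoid setoid
  open import Algebra.Solver.CommutativeMonoid M using (solve; _⊜_; _⊕_; id)

  sumOver : (Word → Carrier) → List Word → Carrier
  sumOver f [] = 0#
  sumOver f (x ∷ xs) = f x + sumOver f xs

  sumOver-cong : ∀ {f g} → (∀ x → f x ≈ g x) → ∀ xs → sumOver f xs ≈ sumOver g xs
  sumOver-cong f≈g [] = refl
  sumOver-cong f≈g (x ∷ xs) = ∙-cong (f≈g x) (sumOver-cong f≈g xs)

  sumOver-++ : ∀ f xs ys → sumOver f (xs ++ ys) ≈ sumOver f xs + sumOver f ys
  sumOver-++ f [] ys = sym (identityˡ _)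
  sumOver-++ f (x ∷ xs) ys = trans (∙-congˡ (sumOver-++ f xs ys)) (sym (assoc _ _ _))

  sumOver-map : ∀ f (h : Word → Word) xs → sumOver f (map h xs) ≡ sumOver (f ∘ h) xs
  sumOver-map f h [] = P.refl
  sumOver-map f h (x ∷ xs) = P.cong (λ z → f (h x) + z) (sumOver-map f h xs)

  sumOver-+ : ∀ f g xs → sumOver (λ x → f x + g x) xs ≈ sumOver f xs + sumOver g xs
  sumOver-+ f g [] = sym (identityˡ _)
  sumOver-+ f g (x ∷ xs) = trans (∙-congˡ (sumOver-+ f g xs))
    (solve 4 (λ a b c d → (a ⊕ b) ⊕ (c ⊕ d) ⊜ (a ⊕ c) ⊕ (b ⊕ d)) refl (f x) (g x) (sumOver f xs) (sumOver g xs))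

  sumOver-congᴬ : ∀ {f g xs} → All (λ x → f x ≈ g x) xs → sumOver f xs ≈ sumOver g xs
  sumOver-congᴬ [] = refl
  sumOver-congᴬ (fx≈gx ∷ rest) = ∙-cong fx≈gx (sumOver-congᴬ rest)

  sumOver-zero : ∀ xs → sumOver (λ _ → 0#) xs ≈ 0#
  sumOver-zero [] = refl
  sumOver-zero (x ∷ xs) = trans (identityˡ _) (sumOver-zero xs)

  sumQsh : (Word → Carrier) → Word → Word → Carrier
  sumQsh f v w = sumOver f (qsh v w)

  sumQsh-∷ : ∀ f m v n w → sumQsh f (m ∷ v) (n ∷ w) ≈
    sumQsh (f ∘ (m ∷_)) v (n ∷ w) + (sumQsh (f ∘ (n ∷_)) (m ∷ v) w + sumQsh (f ∘ ((m ℤ.+ n) ∷_)) v w)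
  sumQsh-∷ f m v n w = begin
    sumOver f (map (m ∷_) xs ++ map (n ∷_) ys ++ map ((m ℤ.+ n) ∷_) zs)
      ≈⟨ trans (sumOver-++ f (map (m ∷_) xs) _) (∙-congˡ (sumOver-++ f (map (n ∷_) ys) _)) ⟩
    sumOver f (map (m ∷_) xs) + (sumOver f (map (n ∷_) ys) + sumOver f (map ((m ℤ.+ n) ∷_) zs))
      ≡⟨ P.cong₂ _+_ (sumOver-map f _ xs) (P.cong₂ _+_ (sumOver-map f _ ys) (sumOver-map f _ zs)) ⟩
    sumOver (f ∘ (m ∷_)) xs + (sumOver (f ∘ (n ∷_)) ys + sumOver (f ∘ ((m ℤ.+ n) ∷_)) zs) ∎
    where
    xs = qsh v (n ∷ w)
    ys = qsh (m ∷ v) w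
    zs = qsh v w

  sumQsh-[]ʳ : ∀ f v → sumQsh f v [] ≡ f v + 0#
  sumQsh-[]ʳ f v = P.cong (sumOver f) (qsh-[]ʳ v)

  sumSplits : (Word → Word → Carrier) → Word → Carrier
  sumSplits F [] = F [] []
  sumSplits F (m ∷ x) = F [] (m ∷ x) + sumSplits (λ u → F (m ∷ u)) x

  sumSplits-cong : ∀ {F G} → (∀ u v → F u v ≈ G u v) → ∀ x → sumSplits F x ≈ sumSplits G x
  sumSplits-cong F≈G [] = F≈G [] []
  sumSplits-cong F≈G (m ∷ x) = ∙-cong (F≈G [] (m ∷ x)) (sumSplits-cong (λ u → F≈G (m ∷ u)) x)

  sumSplits-+ : ∀ F G x → sumSplits (λ u v → F u v + G u v) x ≈ sumSplits F x + sumSplits G x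
  sumSplits-+ F G [] = refl
  sumSplits-+ F G (m ∷ x) = trans (∙-congˡ (sumSplits-+ (λ u → F (m ∷ u)) (λ u → G (m ∷ u)) x))
    (solve 4 (λ a b c d → (a ⊕ b) ⊕ (c ⊕ d) ⊜ (a ⊕ c) ⊕ (b ⊕ d)) refl _ _ _ _)

  sumSplits-zero : ∀ x → sumSplits (λ _ _ → 0#) x ≈ 0#
  sumSplits-zero [] = refl
  sumSplits-zero (m ∷ x) = trans (identityˡ _) (sumSplits-zero x)

  sumSplits₂ : (Word → Word → Word → Word → Carrier) → Word → Word → Carrier
  sumSplits₂ B v w = sumSplits (λ v₁ v₂ → sumSplits (B v₁ v₂) w) v

  sumSplits₂-cong : ∀ {B B′} → (∀ v₁ v₂ w₁ w₂ → B v₁ v₂ w₁ w₂ ≈ B′ v₁ v₂ w₁ w₂) →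
                    ∀ v w → sumSplits₂ B v w ≈ sumSplits₂ B′ v w
  sumSplits₂-cong B≈B′ v w = sumSplits-cong (λ v₁ v₂ → sumSplits-cong (B≈B′ v₁ v₂) w) v

  sumSplits₂-+ : ∀ B B′ v w →
    sumSplits₂ (λ v₁ v₂ w₁ w₂ → B v₁ v₂ w₁ w₂ + B′ v₁ v₂ w₁ w₂) v w ≈ sumSplits₂ B v w + sumSplits₂ B′ v w
  sumSplits₂-+ B B′ v w =
    trans (sumSplits-cong (λ v₁ v₂ → sumSplits-+ (B v₁ v₂) (B′ v₁ v₂) w) v) (sumSplits-+ _ _ v)

  sumQsh₂ : (Word → Word → Carrier) → Word → Word → Word → Word → Carrier
  sumQsh₂ F v₁ v₂ w₁ w₂ = sumQsh (λ x → sumQsh (F x) v₂ w₂) v₁ w₁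

  sumQsh-∷-sumSplits : ∀ F k v w → sumQsh (sumSplits F ∘ (k ∷_)) v w ≈
    sumQsh (F [] ∘ (k ∷_)) v w + sumQsh (sumSplits (λ u → F (k ∷ u))) v w
  sumQsh-∷-sumSplits F k v w = sumOver-+ _ _ (qsh v w)

  sumSplits-sumQsh₂-∷ : ∀ F m v₁ v₂ n w → sumSplits (sumQsh₂ F (m ∷ v₁) v₂) (n ∷ w) ≈
    sumSplits (sumQsh₂ (λ u → F (m ∷ u)) v₁ v₂) (n ∷ w) +
    (sumSplits (sumQsh₂ (λ u → F (n ∷ u)) (m ∷ v₁) v₂) w + sumSplits (sumQsh₂ (λ u → F ((m ℤ.+ n) ∷ u)) v₁ v₂) w)
  sumSplits-sumQsh₂-∷ F m v₁ v₂ n w = begin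
    sumQsh₂ F (m ∷ v₁) v₂ [] (n ∷ w) + sumSplits (λ w₁ → sumQsh₂ F (m ∷ v₁) v₂ (n ∷ w₁)) w
      ≈⟨ ∙-congˡ (trans (sumSplits-cong (λ w₁ w₂ → sumQsh-∷ (λ x → sumQsh (F x) v₂ w₂) m v₁ n w₁) w)
                        (trans (sumSplits-+ _ _ w) (∙-congˡ (sumSplits-+ _ _ w)))) ⟩
    sumQsh₂ F (m ∷ v₁) v₂ [] (n ∷ w) + (sumSplits (λ w₁ → sumQsh₂ Fₘ v₁ v₂ (n ∷ w₁)) w + (Y₂ + Y₃))
      ≈⟨ sym (assoc _ _ _) ⟩
    (sumQsh₂ F (m ∷ v₁) v₂ [] (n ∷ w) + sumSplits (λ w₁ → sumQsh₂ Fₘ v₁ v₂ (n ∷ w₁)) w) + (Y₂ + Y₃)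
      ≡⟨ P.cong (λ t → (t + sumSplits (λ w₁ → sumQsh₂ Fₘ v₁ v₂ (n ∷ w₁)) w) + (Y₂ + Y₃))
                (P.sym (sumQsh-[]ʳ (λ x → sumQsh (Fₘ x) v₂ (n ∷ w)) v₁)) ⟩
    sumSplits (sumQsh₂ Fₘ v₁ v₂) (n ∷ w) + (Y₂ + Y₃) ∎
    where
    Fₘ = λ u → F (m ∷ u)
    Y₂ = sumSplits (sumQsh₂ (λ u → F (n ∷ u)) (m ∷ v₁) v₂) w
    Y₃ = sumSplits (sumQsh₂ (λ u → F ((m ℤ.+ n) ∷ u)) v₁ v₂) w

  -- The bialgebra axiom Δ(v ∗ w) = Δv ∗ Δw, tested against F.
  sumQsh-sumSplits : ∀ F v w → sumQsh (sumSplits F) v w ≈ sumSplits₂ (sumQsh₂ F) v w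
  sumQsh-sumSplits F [] w = trans (identityʳ _)
    (sumSplits-cong (λ w₁ w₂ → sym (trans (identityʳ _) (identityʳ _))) w)
  sumQsh-sumSplits F (m ∷ v) [] = trans (identityʳ _)
    (sumSplits-cong (λ v₁ v₂ → sym (begin
      sumQsh₂ F v₁ v₂ [] []       ≡⟨ sumQsh-[]ʳ (λ x → sumQsh (F x) v₂ []) v₁ ⟩
      sumQsh (F v₁) v₂ [] + 0#    ≈⟨ identityʳ _ ⟩
      sumQsh (F v₁) v₂ []         ≡⟨ sumQsh-[]ʳ (F v₁) v₂ ⟩
      F v₁ v₂ + 0#                ≈⟨ identityʳ _ ⟩
      F v₁ v₂                     ∎)) (m ∷ v))
  sumQsh-sumSplits F (m ∷ v) (n ∷ w) = begin
    sumQsh (sumSplits F) (m ∷ v) (n ∷ w)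
      ≈⟨ sumQsh-∷ (sumSplits F) m v n w ⟩
    sumQsh (sumSplits F ∘ (m ∷_)) v (n ∷ w) +
      (sumQsh (sumSplits F ∘ (n ∷_)) (m ∷ v) w + sumQsh (sumSplits F ∘ ((m ℤ.+ n) ∷_)) v w)
      ≈⟨ ∙-cong (trans (sumQsh-∷-sumSplits F m v (n ∷ w)) (∙-congˡ (sumQsh-sumSplits (Fₖ m) v (n ∷ w))))
                (∙-cong (trans (sumQsh-∷-sumSplits F n (m ∷ v) w) (∙-congˡ (sumQsh-sumSplits (Fₖ n) (m ∷ v) w)))
                        (trans (sumQsh-∷-sumSplits F (m ℤ.+ n) v w) (∙-congˡ (sumQsh-sumSplits (Fₖ (m ℤ.+ n)) v w)))) ⟩
    (Hm + Rm) + ((Hn + (Rn₁ + Rn₂)) + (Hmn + Rmn))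
      ≈⟨ solve 7 (λ hm hn hmn rm rn₁ rn₂ rmn →
                   (hm ⊕ rm) ⊕ ((hn ⊕ (rn₁ ⊕ rn₂)) ⊕ (hmn ⊕ rmn))
                   ⊜ (((hm ⊕ (hn ⊕ hmn)) ⊕ id) ⊕ rn₁) ⊕ (rm ⊕ (rn₂ ⊕ rmn))) refl Hm Hn Hmn Rm Rn₁ Rn₂ Rmn ⟩
    (((Hm + (Hn + Hmn)) + 0#) + Rn₁) + (Rm + (Rn₂ + Rmn))
      ≈⟨ ∙-cong (∙-congʳ (∙-congʳ (sym (sumQsh-∷ (F []) m v n w))))
                (sym (trans (sumSplits-cong (λ v₁ v₂ → sumSplits-sumQsh₂-∷ F m v₁ v₂ n w) v)
                            (trans (sumSplits-+ _ _ v) (∙-congˡ (sumSplits-+ _ _ v))))) ⟩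
    sumSplits₂ (sumQsh₂ F) (m ∷ v) (n ∷ w) ∎
    where
    Fₖ : ℤ → Word → Word → Carrier
    Fₖ k u = F (k ∷ u)
    Hm = sumQsh (F [] ∘ (m ∷_)) v (n ∷ w)
    Hn = sumQsh (F [] ∘ (n ∷_)) (m ∷ v) w
    Hmn = sumQsh (F [] ∘ ((m ℤ.+ n) ∷_)) v w
    Rm = sumSplits₂ (sumQsh₂ (Fₖ m)) v (n ∷ w)
    Rn₁ = sumSplits (sumQsh₂ (Fₖ n) [] (m ∷ v)) w
    Rn₂ = sumSplits (λ v₁ v₂ → sumSplits (sumQsh₂ (Fₖ n) (m ∷ v₁) v₂) w) v
    Rmn = sumSplits₂ (sumQsh₂ (Fₖ (m ℤ.+ n))) v w

-- Derivations of (H, ∗) with values in A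

module Derivations {c ℓ} (A : QAlgebra c ℓ) where
  open QAlgebra A
  open WordSums +-commutativeMonoid
  open IsRingHomomorphism ι-hom using (+-homo; *-homo; -‿homo; 0#-homo; 1#-homo)
  open import Relation.Binary.Reasoning.Setoid setoid

  ι-morphism : ℚ.+-*-rawRing -Raw-AlmostCommutative⟶ fromCommutativeRing commRing
  ι-morphism = record
    { ⟦_⟧ = ι ; +-homo = +-homo ; *-homo = *-homo ; -‿homo = -‿homo ; 0-homo = 0#-homo ; 1-homo = 1#-homo }

  -- With ℚ as coefficient ring the solver also normalises negation and 0 (as con ℚ.0ℚ).
  open RingSolver _ _ ι-morphism (λ p q → Maybe.map (reflexive ∘ P.cong ι) (dec⇒maybe (p ℚ.≟ q)))
    using (solve; _:+_; _:*_; :-_; _:=_; con)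

  open import Algebra.Properties.Ring ring using (-0#≈0#)

  εʷ : Word → Carrier
  εʷ = εw A

  sumOver-*ˡ : ∀ k f xs → sumOver (λ x → k * f x) xs ≈ k * sumOver f xs
  sumOver-*ˡ k f [] = sym (zeroʳ k)
  sumOver-*ˡ k f (x ∷ xs) = trans (+-congˡ (sumOver-*ˡ k f xs)) (sym (distribˡ k _ _))

  sumOver-*ʳ : ∀ k f xs → sumOver (λ x → f x * k) xs ≈ sumOver f xs * k
  sumOver-*ʳ k f [] = sym (zeroˡ k)
  sumOver-*ʳ k f (x ∷ xs) = trans (+-congˡ (sumOver-*ʳ k f xs)) (sym (distribʳ k _ _))

  sumOver-neg : ∀ f xs → sumOver (λ x → - f x) xs ≈ - sumOver f xs
  sumOver-neg f [] = sym -0#≈0#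
  sumOver-neg f (x ∷ xs) = trans (+-congˡ (sumOver-neg f xs))
    (solve 2 (λ a b → :- a :+ :- b := :- (a :+ b)) refl (f x) (sumOver f xs))

  sumSplits-*ˡ : ∀ k (F : Word → Word → Carrier) x → sumSplits (λ u v → k * F u v) x ≈ k * sumSplits F x
  sumSplits-*ˡ k F [] = refl
  sumSplits-*ˡ k F (m ∷ x) = trans (+-congˡ (sumSplits-*ˡ k (λ u → F (m ∷ u)) x)) (sym (distribˡ k _ _))

  sumSplits-*ʳ : ∀ k (F : Word → Word → Carrier) x → sumSplits (λ u v → F u v * k) x ≈ sumSplits F x * k
  sumSplits-*ʳ k F [] = refl
  sumSplits-*ʳ k F (m ∷ x) = trans (+-congˡ (sumSplits-*ʳ k (λ u → F (m ∷ u)) x)) (sym (distribʳ k _ _))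

  Unit : Carrier → Set (c Level.⊔ ℓ)
  Unit u = Σ Carrier (λ u⁻¹ → u * u⁻¹ ≈ 1#)

  ι-unit : ∀ p .{{_ : ℚ.NonZero p}} → Unit (ι p)
  ι-unit p = ι (ℚ.1/ p) , trans (sym (*-homo p (ℚ.1/ p))) (trans (reflexive (P.cong ι (ℚP.*-inverseʳ p))) 1#-homo)

  -‿unit : ∀ {u} → Unit u → Unit (- u)
  -‿unit {u} (u⁻¹ , uu⁻¹≈1) = - u⁻¹ , trans (solve 2 (λ a b → :- a :* :- b := a :* b) refl u u⁻¹) uu⁻¹≈1

  *-unit : ∀ {u v} → Unit u → Unit v → Unit (u * v)
  *-unit {u} {v} (u⁻¹ , uu⁻¹≈1) (v⁻¹ , vv⁻¹≈1) = u⁻¹ * v⁻¹ ,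
    trans (solve 4 (λ a b c d → (a :* c) :* (b :* d) := (a :* b) :* (c :* d)) refl u u⁻¹ v v⁻¹)
          (trans (*-cong uu⁻¹≈1 vv⁻¹≈1) (*-identityˡ 1#))

  unit-cong : ∀ {u v} → u ≈ v → Unit v → Unit u
  unit-cong u≈v (v⁻¹ , vv⁻¹≈1) = v⁻¹ , trans (*-congʳ u≈v) vv⁻¹≈1

  unit-cancelʳ : ∀ {a u} → Unit u → a * u ≈ 0# → a ≈ 0#
  unit-cancelʳ {a} {u} (u⁻¹ , uu⁻¹≈1) au≈0 = begin
    a                ≈⟨ sym (*-identityʳ a) ⟩
    a * 1#           ≈⟨ *-congˡ (sym uu⁻¹≈1) ⟩
    a * (u * u⁻¹)    ≈⟨ sym (*-assoc a u u⁻¹) ⟩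
    (a * u) * u⁻¹    ≈⟨ *-congʳ au≈0 ⟩
    0# * u⁻¹         ≈⟨ zeroˡ u⁻¹ ⟩
    0#               ∎

  ∑-single : ∀ n (g : Fin n → Carrier) j → (∀ i → i ≢ j → g i ≈ 0#) → ∑ A n g ≈ g j
  ∑-single (ℕ.suc n) g Fin.zero g≈0 =
    trans (+-congˡ (∑-zero n (λ i → g (Fin.suc i)) (λ i → g≈0 (Fin.suc i) (λ ())))) (+-identityʳ _)
    where
    ∑-zero : ∀ n (g : Fin n → Carrier) → (∀ i → g i ≈ 0#) → ∑ A n g ≈ 0#
    ∑-zero ℕ.zero g g≈0 = refl
    ∑-zero (ℕ.suc n) g g≈0 = trans (+-cong (g≈0 Fin.zero) (∑-zero n (λ i → g (Fin.suc i)) (λ i → g≈0 (Fin.suc i))))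
                                   (+-identityʳ _)
  ∑-single (ℕ.suc n) g (Fin.suc j) g≈0 =
    trans (+-cong (g≈0 Fin.zero (λ ())) (∑-single n (λ i → g (Fin.suc i)) j
                                          (λ i i≢j → g≈0 (Fin.suc i) (i≢j ∘ FinP.suc-injective))))
          (+-identityˡ _)

  lin-cong : ∀ {f g} → (∀ w → f w ≈ g w) → ∀ x → lin A f x ≈ lin A g x
  lin-cong f≈g [] = refl
  lin-cong f≈g ((q , w) ∷ x) = +-cong (*-congˡ (f≈g w)) (lin-cong f≈g x)

  lin-++ : ∀ f x y → lin A f (x ++ y) ≈ lin A f x + lin A f y
  lin-++ f [] y = sym (+-identityˡ _)
  lin-++ f ((q , w) ∷ x) y = trans (+-congˡ (lin-++ f x y)) (sym (+-assoc _ _ _))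

  lin-+ : ∀ f g x → lin A (λ w → f w + g w) x ≈ lin A f x + lin A g x
  lin-+ f g [] = sym (+-identityˡ _)
  lin-+ f g ((q , w) ∷ x) = trans (+-congˡ (lin-+ f g x))
    (solve 5 (λ q a b c d → q :* (a :+ b) :+ (c :+ d) := (q :* a :+ c) :+ (q :* b :+ d)) refl
       (ι q) (f w) (g w) (lin A f x) (lin A g x))

  lin-*ˡ : ∀ k f x → lin A (λ w → k * f w) x ≈ k * lin A f x
  lin-*ˡ k f [] = sym (zeroʳ k)
  lin-*ˡ k f ((q , w) ∷ x) = trans (+-congˡ (lin-*ˡ k f x))
    (solve 4 (λ q k a b → q :* (k :* a) :+ k :* b := k :* (q :* a :+ b)) refl (ι q) k (f w) (lin A f x))

  lin-*ʳ : ∀ k f x → lin A (λ w → f w * k) x ≈ lin A f x * k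
  lin-*ʳ k f x = trans (lin-cong (λ w → *-comm (f w) k) x) (trans (lin-*ˡ k f x) (*-comm k _))

  lin-⟪⟫ : ∀ f w → lin A f ⟪ w ⟫ ≈ f w
  lin-⟪⟫ f w = trans (+-identityʳ _) (trans (*-congʳ 1#-homo) (*-identityˡ (f w)))

  lin-concatMap : ∀ f g (G : ℚ × Word → H) → (∀ q w → lin A f (G (q , w)) ≈ ι q * g w) →
                  ∀ y → lin A f (concatMap G y) ≈ lin A g y
  lin-concatMap f g G G≈ [] = refl
  lin-concatMap f g G G≈ ((q , w) ∷ y) =
    trans (lin-++ f (G (q , w)) (concatMap G y)) (+-cong (G≈ q w) (lin-concatMap f g G G≈ y))

  lin-map-scaled : ∀ f r ws → lin A f (map (λ u → (r , u)) ws) ≈ ι r * sumOver f ws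
  lin-map-scaled f r [] = sym (zeroʳ _)
  lin-map-scaled f r (u ∷ ws) = trans (+-congˡ (lin-map-scaled f r ws)) (sym (distribˡ _ _ _))

  lin-∗ : ∀ f x y → lin A f (x ∗ y) ≈ lin A (λ v → lin A (sumQsh f v) y) x
  lin-∗ f x y = lin-concatMap f _ _ (λ p v →
    trans (lin-concatMap f (λ w → ι p * sumQsh f v w) _ (λ q w → begin
              lin A f (map (λ u → (p ℚ.* q , u)) (qsh v w)) ≈⟨ lin-map-scaled f (p ℚ.* q) (qsh v w) ⟩
              ι (p ℚ.* q) * sumQsh f v w                  ≈⟨ *-congʳ (*-homo p q) ⟩
              (ι p * ι q) * sumQsh f v w
                ≈⟨ solve 3 (λ a b s → (a :* b) :* s := b :* (a :* s)) refl (ι p) (ι q) (sumQsh f v w) ⟩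
              ι q * (ι p * sumQsh f v w)                  ∎) y)
          (lin-*ˡ (ι p) (sumQsh f v) y)) x


  εʷ-qsh : ∀ v w → sumQsh εʷ v w ≈ εʷ v * εʷ w
  εʷ-qsh [] w = trans (+-identityʳ _) (sym (*-identityˡ _))
  εʷ-qsh (m ∷ v) [] = trans (+-identityʳ _) (sym (zeroˡ _))
  εʷ-qsh (m ∷ v) (n ∷ w) = begin
    sumQsh εʷ (m ∷ v) (n ∷ w)
      ≈⟨ sumQsh-∷ εʷ m v n w ⟩
    sumOver (λ _ → 0#) (qsh v (n ∷ w)) + (sumOver (λ _ → 0#) (qsh (m ∷ v) w) + sumOver (λ _ → 0#) (qsh v w))
      ≈⟨ +-cong (sumOver-zero (qsh v (n ∷ w))) (+-cong (sumOver-zero (qsh (m ∷ v) w)) (sumOver-zero (qsh v w))) ⟩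
    0# + (0# + 0#) ≈⟨ trans (+-identityˡ _) (+-identityˡ _) ⟩
    0#             ≈⟨ sym (zeroˡ 0#) ⟩
    0# * 0#        ∎

  sumSplits-εʷˡ : ∀ (F : Word → Word → Carrier) x → sumSplits (λ u v → εʷ u * F u v) x ≈ F [] x
  sumSplits-εʷˡ F [] = *-identityˡ _
  sumSplits-εʷˡ F (m ∷ x) = begin
    1# * F [] (m ∷ x) + sumSplits (λ u v → 0# * F (m ∷ u) v) x
      ≈⟨ +-cong (*-identityˡ _) (sumSplits-cong {G = λ _ _ → 0#} (λ u v → zeroˡ (F (m ∷ u) v)) x) ⟩
    F [] (m ∷ x) + sumSplits (λ _ _ → 0#) x ≈⟨ +-congˡ (sumSplits-zero x) ⟩
    F [] (m ∷ x) + 0#                        ≈⟨ +-identityʳ _ ⟩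
    F [] (m ∷ x)                             ∎

  sumSplits-εʷʳ : ∀ (F : Word → Word → Carrier) x → sumSplits (λ u v → F u v * εʷ v) x ≈ F x []
  sumSplits-εʷʳ F [] = *-identityʳ _
  sumSplits-εʷʳ F (m ∷ x) =
    trans (+-cong (zeroʳ _) (sumSplits-εʷʳ (λ u → F (m ∷ u)) x)) (+-identityˡ _)

  Leibniz : (Word → Carrier) → Word → Word → Set ℓ
  Leibniz f v w = sumQsh f v w ≈ f v * εʷ w + εʷ v * f w

  IsDerivation : (Word → Carrier) → Set ℓ
  IsDerivation f = ∀ v w → Leibniz f v w

  derivation-[] : ∀ {f} → IsDerivation f → f [] ≈ 0#
  derivation-[] {f} d = begin
    f []                         ≈⟨ sym (+-identityˡ _) ⟩
    0# + f []                    ≈⟨ +-congʳ (sym (-‿inverseˡ (f []))) ⟩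
    (- f [] + f []) + f []       ≈⟨ +-assoc _ _ _ ⟩
    - f [] + (f [] + f [])       ≈⟨ +-congˡ (sym double) ⟩
    - f [] + f []                ≈⟨ -‿inverseˡ (f []) ⟩
    0#                           ∎
    where
    double : f [] ≈ f [] + f []
    double = trans (sym (+-identityʳ _))
             (trans (d [] []) (+-cong (*-identityʳ _) (*-identityˡ _)))

  leibniz-[]ˡ : ∀ {f} → f [] ≈ 0# → ∀ w → Leibniz f [] w
  leibniz-[]ˡ {f} f[]≈0 w = begin
    f w + 0#                 ≈⟨ +-identityʳ _ ⟩
    f w                      ≈⟨ sym (+-identityˡ _) ⟩
    0# + f w                 ≈⟨ +-cong (sym (trans (*-congʳ f[]≈0) (zeroˡ _))) (sym (*-identityˡ _)) ⟩
    f [] * εʷ w + 1# * f w   ∎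

  leibniz-[]ʳ : ∀ {f} → f [] ≈ 0# → ∀ v → Leibniz f v []
  leibniz-[]ʳ {f} f[]≈0 v = begin
    sumQsh f v []            ≡⟨ sumQsh-[]ʳ f v ⟩
    f v + 0#                 ≈⟨ +-cong (sym (*-identityʳ _)) (sym (trans (*-congˡ f[]≈0) (zeroʳ _))) ⟩
    f v * 1# + εʷ v * f []   ∎

  leibniz-∷ʳ : ∀ {f} v n w → Leibniz f v (n ∷ w) → sumQsh f v (n ∷ w) ≈ εʷ v * f (n ∷ w)
  leibniz-∷ʳ v n w l = trans l (trans (+-congʳ (zeroʳ _)) (+-identityˡ _))

  leibniz-∷ˡ : ∀ {f} m v w → Leibniz f (m ∷ v) w → sumQsh f (m ∷ v) w ≈ f (m ∷ v) * εʷ w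
  leibniz-∷ˡ m v w l = trans l (trans (+-congˡ (zeroˡ _)) (+-identityʳ _))

  leibniz-∷ : ∀ {f} m v n w → sumQsh f (m ∷ v) (n ∷ w) ≈ 0# → Leibniz f (m ∷ v) (n ∷ w)
  leibniz-∷ m v n w q≈0 = trans q≈0 (sym (trans (+-cong (zeroʳ _) (zeroˡ _)) (+-identityˡ _)))

  isDerivation : ∀ {f} → f [] ≈ 0# → (∀ m v n w → sumQsh f (m ∷ v) (n ∷ w) ≈ 0#) → IsDerivation f
  isDerivation {f} f[]≈0 products [] w = leibniz-[]ˡ {f} f[]≈0 w
  isDerivation {f} f[]≈0 products (m ∷ v) [] = leibniz-[]ʳ {f} f[]≈0 (m ∷ v)
  isDerivation {f} f[]≈0 products (m ∷ v) (n ∷ w) = leibniz-∷ {f} m v n w (products m v n w)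

  derivation-∷ : ∀ {f} → IsDerivation f → ∀ m v n w → sumQsh f (m ∷ v) (n ∷ w) ≈ 0#
  derivation-∷ d m v n w = trans (d (m ∷ v) (n ∷ w)) (trans (+-cong (zeroʳ _) (zeroˡ _)) (+-identityˡ _))

  ε-∗ : ∀ x y → ε A (x ∗ y) ≈ ε A x * ε A y
  ε-∗ x y = begin
    ε A (x ∗ y)                                      ≈⟨ lin-∗ εʷ x y ⟩
    lin A (λ v → lin A (sumQsh εʷ v) y) x            ≈⟨ lin-cong (λ v → trans (lin-cong (εʷ-qsh v) y) (lin-*ˡ (εʷ v) εʷ y)) x ⟩
    lin A (λ v → εʷ v * ε A y) x                     ≈⟨ lin-*ʳ (ε A y) εʷ x ⟩
    ε A x * ε A y                                    ∎

  lin-∗-leibniz : ∀ {f} → IsDerivation f → ∀ x y → lin A f (x ∗ y) ≈ lin A f x * ε A y + ε A x * lin A f y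
  lin-∗-leibniz {f} d x y = begin
    lin A f (x ∗ y)                                              ≈⟨ lin-∗ f x y ⟩
    lin A (λ v → lin A (sumQsh f v) y) x                         ≈⟨ lin-cong inner x ⟩
    lin A (λ v → f v * ε A y + εʷ v * lin A f y) x               ≈⟨ lin-+ _ _ x ⟩
    lin A (λ v → f v * ε A y) x + lin A (λ v → εʷ v * lin A f y) x
      ≈⟨ +-cong (lin-*ʳ (ε A y) f x) (lin-*ʳ (lin A f y) εʷ x) ⟩
    lin A f x * ε A y + ε A x * lin A f y                        ∎
    where
    inner : ∀ v → lin A (sumQsh f v) y ≈ f v * ε A y + εʷ v * lin A f y
    inner v = trans (lin-cong (d v) y)
              (trans (lin-+ _ _ y) (+-cong (lin-*ˡ (f v) εʷ y) (lin-*ˡ (εʷ v) f y)))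

  derivation-vanishesOn𝒩 : ∀ {f} → IsDerivation f → (∀ n → NonSingular n → f n ≈ 0#) → VanishesOn𝒩 A f
  derivation-vanishesOn𝒩 {f} d f[N]≈0 x y n@(_ ∷ _) ns = begin
    lin A f ((x ∗ ⟪ n ⟫) ∗ y)                                  ≈⟨ lin-∗-leibniz d (x ∗ ⟪ n ⟫) y ⟩
    lin A f (x ∗ ⟪ n ⟫) * ε A y + ε A (x ∗ ⟪ n ⟫) * lin A f y  ≈⟨ +-cong (*-congʳ f[x∗n]≈0) (*-congʳ ε[x∗n]≈0) ⟩
    0# * ε A y + 0# * lin A f y                               ≈⟨ trans (+-cong (zeroˡ _) (zeroˡ _)) (+-identityʳ _) ⟩
    0#                                                        ∎
    where
    ε[n]≈0 : ε A ⟪ n ⟫ ≈ 0#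
    ε[n]≈0 = lin-⟪⟫ εʷ n
    f[x∗n]≈0 : lin A f (x ∗ ⟪ n ⟫) ≈ 0#
    f[x∗n]≈0 = trans (lin-∗-leibniz d x ⟪ n ⟫)
      (trans (+-cong (trans (*-congˡ ε[n]≈0) (zeroʳ _)) (trans (*-congˡ (trans (lin-⟪⟫ f n) (f[N]≈0 n ns))) (zeroʳ _)))
             (+-identityʳ _))
    ε[x∗n]≈0 : ε A (x ∗ ⟪ n ⟫) ≈ 0#
    ε[x∗n]≈0 = trans (ε-∗ x ⟪ n ⟫) (trans (*-congˡ ε[n]≈0) (zeroʳ _))

  derivation⇒𝔱 : ∀ f → IsDerivation f → (∀ n → NonSingular n → f n ≈ 0#) → 𝔱 A
  derivation⇒𝔱 f d f[N]≈0 = f , derivation-vanishesOn𝒩 d f[N]≈0 , lin-∗-leibniz d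

  -- signedLast g (z_{k₁}⋯z_{kₙ}) = (-1)ⁿ g(kₙ)
  signedLast : (ℤ → Carrier) → Word → Carrier
  signedLast g [] = 0#
  signedLast g (m ∷ x) = - (signedLast g x + εʷ x * g m)

  signedLast-∷ : ∀ g → (∀ m n → g (m ℤ.+ n) ≈ g m + g n) → ∀ m v n w →
    Leibniz (signedLast g) v (n ∷ w) → Leibniz (signedLast g) (m ∷ v) w → Leibniz (signedLast g) v w →
    sumQsh (signedLast g) (m ∷ v) (n ∷ w) ≈ 0#
  signedLast-∷ g g-homo m v n w ih₁ ih₂ ih₃ = begin
    sumQsh L (m ∷ v) (n ∷ w)
      ≈⟨ sumQsh-∷ L m v n w ⟩
    sumQsh (L ∘ (m ∷_)) v (n ∷ w) + (sumQsh (L ∘ (n ∷_)) (m ∷ v) w + sumQsh (L ∘ ((m ℤ.+ n) ∷_)) v w)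
      ≈⟨ +-cong (trans (prefix m v (n ∷ w)) (-‿cong t₁))
                (+-cong (trans (prefix n (m ∷ v) w) (-‿cong t₂)) (trans (prefix (m ℤ.+ n) v w) (-‿cong t₃))) ⟩
    - (e * - (b + f * q)) + (- (- (a + e * p) * f) + - ((a * f + e * b) + (e * f) * (p + q)))
      ≈⟨ solve 6 (λ a b e f p q → :- (e :* :- (b :+ f :* q)) :+ (:- (:- (a :+ e :* p) :* f)
                     :+ :- ((a :* f :+ e :* b) :+ (e :* f) :* (p :+ q))) := con ℚ.0ℚ) refl a b e f p q ⟩
    ι ℚ.0ℚ
      ≈⟨ 0#-homo ⟩
    0# ∎
    where
    L = signedLast g
    a = L v
    b = L w
    e = εʷ v
    f = εʷ w
    p = g m
    q = g n
    prefix : ∀ k x y → sumQsh (L ∘ (k ∷_)) x y ≈ - (sumQsh L x y + sumQsh εʷ x y * g k)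
    prefix k x y = trans (sumOver-neg _ (qsh x y))
      (-‿cong (trans (sumOver-+ L _ (qsh x y)) (+-congˡ (sumOver-*ʳ (g k) εʷ (qsh x y)))))
    t₁ : sumQsh L v (n ∷ w) + sumQsh εʷ v (n ∷ w) * p ≈ e * L (n ∷ w)
    t₁ = trans (+-cong (leibniz-∷ʳ {L} v n w ih₁) (trans (*-congʳ (trans (εʷ-qsh v (n ∷ w)) (zeroʳ e))) (zeroˡ p)))
               (+-identityʳ _)
    t₂ : sumQsh L (m ∷ v) w + sumQsh εʷ (m ∷ v) w * q ≈ L (m ∷ v) * f
    t₂ = trans (+-cong (leibniz-∷ˡ {L} m v w ih₂) (trans (*-congʳ (trans (εʷ-qsh (m ∷ v) w) (zeroˡ f))) (zeroˡ q)))
               (+-identityʳ _)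
    t₃ : sumQsh L v w + sumQsh εʷ v w * g (m ℤ.+ n) ≈ (a * f + e * b) + (e * f) * (p + q)
    t₃ = +-cong ih₃ (*-cong (εʷ-qsh v w) (g-homo m n))

  signedLast-derivation : ∀ g → (∀ m n → g (m ℤ.+ n) ≈ g m + g n) → IsDerivation (signedLast g)
  signedLast-derivation g g-homo [] w = leibniz-[]ˡ {signedLast g} refl w
  signedLast-derivation g g-homo (m ∷ v) [] = leibniz-[]ʳ {signedLast g} refl (m ∷ v)
  signedLast-derivation g g-homo (m ∷ v) (n ∷ w) = leibniz-∷ {signedLast g} m v n w
    (signedLast-∷ g g-homo m v n w (signedLast-derivation g g-homo v (n ∷ w))
      (signedLast-derivation g g-homo (m ∷ v) w) (signedLast-derivation g g-homo v w))

  restrict : ℤ → (Word → Carrier) → Word → Carrier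
  restrict s f x with weight x ℤ.≟ s
  ... | yes _ = f x
  ... | no _ = 0#

  restrict-≡ : ∀ s f x → weight x ≡ s → restrict s f x ≈ f x
  restrict-≡ s f x wx≡s with weight x ℤ.≟ s
  ... | yes _ = refl
  ... | no wx≢s = contradiction wx≡s wx≢s

  restrict-≢ : ∀ s f x → weight x ≢ s → restrict s f x ≈ 0#
  restrict-≢ s f x wx≢s with weight x ℤ.≟ s
  ... | yes wx≡s = contradiction wx≡s wx≢s
  ... | no _ = refl

  restrict-zero : ∀ s f x → f x ≈ 0# → restrict s f x ≈ 0#
  restrict-zero s f x fx≈0 with weight x ℤ.≟ s
  ... | yes _ = fx≈0
  ... | no _ = refl

  sumOver-restrict : ∀ s f t xs → All (λ x → weight x ≡ t) xs → sumOver f xs ≈ 0# → sumOver (restrict s f) xs ≈ 0#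
  sumOver-restrict s f t xs weights Σf≈0 with t ℤ.≟ s
  ... | yes t≡s = trans (sumOver-congᴬ (All.map (λ {x} wx≡t → restrict-≡ s f x (P.trans wx≡t t≡s)) weights)) Σf≈0
  ... | no t≢s = trans (sumOver-congᴬ (All.map (λ {x} wx≡t → restrict-≢ s f x (λ wx≡s → t≢s (P.trans (P.sym wx≡t) wx≡s))) weights))
                       (sumOver-zero xs)

  restrict-derivation : ∀ s {f} → IsDerivation f → IsDerivation (restrict s f)
  restrict-derivation s {f} d = isDerivation {restrict s f} (restrict-zero s f [] (derivation-[] d)) λ m v n w →
    sumOver-restrict s f _ (qsh (m ∷ v) (n ∷ w)) (qsh-weight (m ∷ v) (n ∷ w)) (derivation-∷ d m v n w)

  _⋆_ : (Word → Carrier) → (Word → Carrier) → Word → Carrier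
  (α ⋆ β) = sumSplits (λ u v → α u * β v)

  ⋆-identityˡ : ∀ f x → (εʷ ⋆ f) x ≈ f x
  ⋆-identityˡ f = sumSplits-εʷˡ (λ _ v → f v)

  ⋆-identityʳ : ∀ f x → (f ⋆ εʷ) x ≈ f x
  ⋆-identityʳ f = sumSplits-εʷʳ (λ u _ → f u)

  sumQsh₂-* : ∀ α β v₁ v₂ w₁ w₂ → sumQsh₂ (λ x y → α x * β y) v₁ v₂ w₁ w₂ ≈ sumQsh α v₁ w₁ * sumQsh β v₂ w₂
  sumQsh₂-* α β v₁ v₂ w₁ w₂ = trans (sumOver-cong (λ x → sumOver-*ˡ (α x) β (qsh v₂ w₂)) (qsh v₁ w₁))
                                    (sumOver-*ʳ (sumQsh β v₂ w₂) α (qsh v₁ w₁))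

  sumSplits₂-* : ∀ f f′ g g′ v w →
    sumSplits₂ (λ v₁ v₂ w₁ w₂ → (f v₁ * g w₁) * (f′ v₂ * g′ w₂)) v w ≈ (f ⋆ f′) v * (g ⋆ g′) w
  sumSplits₂-* f f′ g g′ v w = begin
    sumSplits₂ (λ v₁ v₂ w₁ w₂ → (f v₁ * g w₁) * (f′ v₂ * g′ w₂)) v w
      ≈⟨ sumSplits₂-cong (λ v₁ v₂ w₁ w₂ → solve 4 (λ a b c d → (a :* c) :* (b :* d) := (a :* b) :* (c :* d)) refl
                                             (f v₁) (f′ v₂) (g w₁) (g′ w₂)) v w ⟩
    sumSplits (λ v₁ v₂ → sumSplits (λ w₁ w₂ → (f v₁ * f′ v₂) * (g w₁ * g′ w₂)) w) v
      ≈⟨ sumSplits-cong (λ v₁ v₂ → sumSplits-*ˡ (f v₁ * f′ v₂) (λ w₁ w₂ → g w₁ * g′ w₂) w) v ⟩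
    sumSplits (λ v₁ v₂ → (f v₁ * f′ v₂) * (g ⋆ g′) w) v
      ≈⟨ sumSplits-*ʳ ((g ⋆ g′) w) (λ v₁ v₂ → f v₁ * f′ v₂) v ⟩
    (f ⋆ f′) v * (g ⋆ g′) w ∎

  ⋆-leibniz : ∀ {α β} → IsDerivation α → IsDerivation β → ∀ m v n w →
              sumQsh (α ⋆ β) (m ∷ v) (n ∷ w) ≈ α (m ∷ v) * β (n ∷ w) + α (n ∷ w) * β (m ∷ v)
  ⋆-leibniz {α} {β} dα dβ m v n w = begin
    sumQsh (α ⋆ β) V W
      ≈⟨ sumQsh-sumSplits (λ x y → α x * β y) V W ⟩
    sumSplits₂ (sumQsh₂ (λ x y → α x * β y)) V W
      ≈⟨ sumSplits₂-cong (λ v₁ v₂ w₁ w₂ → trans (sumQsh₂-* α β v₁ v₂ w₁ w₂) (trans (*-cong (dα v₁ w₁) (dβ v₂ w₂))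
            (solve 4 (λ a b c d → (a :+ b) :* (c :+ d) := (a :* c :+ a :* d) :+ (b :* c :+ b :* d)) refl _ _ _ _))) V W ⟩
    sumSplits₂ (λ v₁ v₂ w₁ w₂ → (T₁ v₁ v₂ w₁ w₂ + T₂ v₁ v₂ w₁ w₂) + (T₃ v₁ v₂ w₁ w₂ + T₄ v₁ v₂ w₁ w₂)) V W
      ≈⟨ trans (sumSplits₂-+ (λ v₁ v₂ w₁ w₂ → T₁ v₁ v₂ w₁ w₂ + T₂ v₁ v₂ w₁ w₂)
                             (λ v₁ v₂ w₁ w₂ → T₃ v₁ v₂ w₁ w₂ + T₄ v₁ v₂ w₁ w₂) V W)
               (+-cong (sumSplits₂-+ T₁ T₂ V W) (sumSplits₂-+ T₃ T₄ V W)) ⟩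
    (sumSplits₂ T₁ V W + sumSplits₂ T₂ V W) + (sumSplits₂ T₃ V W + sumSplits₂ T₄ V W)
      ≈⟨ +-cong (+-cong (sumSplits₂-* α β εʷ εʷ V W) (sumSplits₂-* α εʷ εʷ β V W))
                (+-cong (sumSplits₂-* εʷ β α εʷ V W) (sumSplits₂-* εʷ εʷ α β V W)) ⟩
    ((α ⋆ β) V * (εʷ ⋆ εʷ) W + (α ⋆ εʷ) V * (εʷ ⋆ β) W) + ((εʷ ⋆ β) V * (α ⋆ εʷ) W + (εʷ ⋆ εʷ) V * (α ⋆ β) W)
      ≈⟨ +-cong (+-cong (trans (*-congˡ (⋆-identityˡ εʷ W)) (zeroʳ _)) (*-cong (⋆-identityʳ α V) (⋆-identityˡ β W)))
                (+-cong (*-cong (⋆-identityˡ β V) (⋆-identityʳ α W)) (trans (*-congʳ (⋆-identityˡ εʷ V)) (zeroˡ _))) ⟩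
    (0# + α V * β W) + (β V * α W + 0#)
      ≈⟨ +-cong (+-identityˡ _) (trans (+-identityʳ _) (*-comm _ _)) ⟩
    α V * β W + α W * β V ∎
    where
    V = m ∷ v
    W = n ∷ w
    T₁ T₂ T₃ T₄ : Word → Word → Word → Word → Carrier
    T₁ v₁ v₂ w₁ w₂ = (α v₁ * εʷ w₁) * (β v₂ * εʷ w₂)
    T₂ v₁ v₂ w₁ w₂ = (α v₁ * εʷ w₁) * (εʷ v₂ * β w₂)
    T₃ v₁ v₂ w₁ w₂ = (εʷ v₁ * α w₁) * (β v₂ * εʷ w₂)
    T₄ v₁ v₂ w₁ w₂ = (εʷ v₁ * α w₁) * (εʷ v₂ * β w₂)

  ⁅_,_⁆ : (Word → Carrier) → (Word → Carrier) → Word → Carrier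
  ⁅ α , β ⁆ x = (α ⋆ β) x - (β ⋆ α) x

  ⁅⁆-derivation : ∀ {α β} → IsDerivation α → IsDerivation β → IsDerivation ⁅ α , β ⁆
  ⁅⁆-derivation {α} {β} dα dβ = isDerivation {⁅ α , β ⁆} ⁅⁆[]≈0 λ m v n w → begin
    sumQsh ⁅ α , β ⁆ (m ∷ v) (n ∷ w)
      ≈⟨ trans (sumOver-+ _ _ (qsh (m ∷ v) (n ∷ w))) (+-congˡ (sumOver-neg (β ⋆ α) (qsh (m ∷ v) (n ∷ w)))) ⟩
    sumQsh (α ⋆ β) (m ∷ v) (n ∷ w) - sumQsh (β ⋆ α) (m ∷ v) (n ∷ w)
      ≈⟨ +-cong (⋆-leibniz dα dβ m v n w) (-‿cong (⋆-leibniz dβ dα m v n w)) ⟩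
    (α (m ∷ v) * β (n ∷ w) + α (n ∷ w) * β (m ∷ v)) - (β (m ∷ v) * α (n ∷ w) + β (n ∷ w) * α (m ∷ v))
      ≈⟨ solve 4 (λ a b c d → (a :* b :+ c :* d) :+ :- (d :* c :+ b :* a) := con ℚ.0ℚ) refl
           (α (m ∷ v)) (β (n ∷ w)) (α (n ∷ w)) (β (m ∷ v)) ⟩
    ι ℚ.0ℚ ≈⟨ 0#-homo ⟩
    0# ∎
    where
    ⁅⁆[]≈0 : ⁅ α , β ⁆ [] ≈ 0#
    ⁅⁆[]≈0 = trans (solve 2 (λ a b → a :* b :+ :- (b :* a) := con ℚ.0ℚ) refl (α []) (β [])) 0#-homo

  ⁅⁆-pair : ∀ {α β} a b → α [] ≈ 0# → β [] ≈ 0# → β (a ∷ []) ≈ 0# →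
            ⁅ α , β ⁆ (a ∷ b ∷ []) ≈ α (a ∷ []) * β (b ∷ [])
  ⁅⁆-pair {α} {β} a b α[]≈0 β[]≈0 β[a]≈0 = begin
    (α [] * β ab + (α [ a ] * β [ b ] + α ab * β [])) - (β [] * α ab + (β [ a ] * α [ b ] + β ab * α []))
      ≈⟨ +-cong (+-cong (killˡ α[]≈0) (+-congˡ (killʳ β[]≈0)))
                (-‿cong (+-cong (killˡ β[]≈0) (+-cong (killˡ β[a]≈0) (killʳ α[]≈0)))) ⟩
    (o + (α [ a ] * β [ b ] + o)) - (o + (o + o))
      ≈⟨ solve 1 (λ t → (con ℚ.0ℚ :+ (t :+ con ℚ.0ℚ)) :+ :- (con ℚ.0ℚ :+ (con ℚ.0ℚ :+ con ℚ.0ℚ)) := t) refl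
           (α [ a ] * β [ b ]) ⟩
    α [ a ] * β [ b ] ∎
    where
    [_] : ℤ → Word
    [ k ] = k ∷ []
    ab = a ∷ b ∷ []
    o = ι ℚ.0ℚ
    killˡ : ∀ {x y} → x ≈ 0# → x * y ≈ o
    killˡ x≈0 = trans (*-congʳ x≈0) (trans (zeroˡ _) (sym 0#-homo))
    killʳ : ∀ {x y} → y ≈ 0# → x * y ≈ o
    killʳ y≈0 = trans (*-congˡ y≈0) (trans (zeroʳ _) (sym 0#-homo))

  -- The derivations δ_k

  ιℤ : ℤ → Carrier
  ιℤ k = ι (fromℤ k)

  ιℤ-homo-+ : ∀ m n → ιℤ (m ℤ.+ n) ≈ ιℤ m + ιℤ n
  ιℤ-homo-+ m n = trans (reflexive (P.cong ι (fromℤ-homo-+ m n))) (+-homo _ _)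

  L : Word → Carrier
  L = signedLast ιℤ

  L-derivation : IsDerivation L
  L-derivation = signedLast-derivation ιℤ ιℤ-homo-+

  L-letter : ∀ k → L (k ∷ []) ≈ - ιℤ k
  L-letter k = -‿cong (trans (+-identityˡ _) (*-identityˡ _))

  δ : ℕ → Word → Carrier
  δ k = restrict (+ 1) ⁅ L , restrict -[1+ k ] L ⁆

  δ-derivation : ∀ k → IsDerivation (δ k)
  δ-derivation k = restrict-derivation (+ 1) (⁅⁆-derivation L-derivation (restrict-derivation -[1+ k ] L-derivation))

  δ-nonSingular : ∀ k n → NonSingular n → δ k n ≈ 0#
  δ-nonSingular k n ns = restrict-≢ (+ 1) _ n (nonSingular⇒weight≢1 n ns)

  δ∈𝔱 : ℕ → 𝔱 A
  δ∈𝔱 k = derivation⇒𝔱 (δ k) (δ-derivation k) (δ-nonSingular k)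

  δ-probe : ∀ k j → δ k (probe j) ≈ L (+ ℕ.suc (ℕ.suc j) ∷ []) * restrict -[1+ k ] L (-[1+ j ] ∷ [])
  δ-probe k j = trans (restrict-≡ (+ 1) _ (probe j) (weight-probe j))
    (⁅⁆-pair {L} {restrict -[1+ k ] L} (+ ℕ.suc (ℕ.suc j)) -[1+ j ] (derivation-[] L-derivation)
             (restrict-zero -[1+ k ] L [] (derivation-[] L-derivation))
             (restrict-≢ -[1+ k ] L (+ ℕ.suc (ℕ.suc j) ∷ []) (λ ())))

  δ-probe-≢ : ∀ k j → k ≢ j → δ k (probe j) ≈ 0#
  δ-probe-≢ k j k≢j = trans (δ-probe k j) (trans (*-congˡ (restrict-≢ -[1+ k ] L (-[1+ j ] ∷ []) weight≢)) (zeroʳ _))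
    where
    weight≢ : weight (-[1+ j ] ∷ []) ≢ -[1+ k ]
    weight≢ e = k≢j (P.sym (ℤP.-[1+-injective (P.trans (P.sym (ℤP.+-identityʳ -[1+ j ])) e)))

  δ-probe-unit : ∀ j → Unit (δ j (probe j))
  δ-probe-unit j = unit-cong (trans (δ-probe j j) (*-congˡ (restrict-≡ -[1+ j ] L (-[1+ j ] ∷ []) (ℤP.+-identityʳ _))))
    (*-unit (unit-cong (L-letter _) (-‿unit (ι-unit (fromℤ (+ ℕ.suc (ℕ.suc j))))))
            (unit-cong (L-letter _) (-‿unit (ι-unit (fromℤ -[1+ j ])))))

  δ-linearlyIndependent : ∀ n → LinIndep A n (δ∈𝔱 ∘ toℕ)
  δ-linearlyIndependent n a ∑≈0 j = unit-cancelʳ (δ-probe-unit (toℕ j)) (begin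
    a j * δ (toℕ j) (probe (toℕ j))
      ≈⟨ sym (∑-single n (λ i → a i * δ (toℕ i) (probe (toℕ j))) j (λ i i≢j →
              trans (*-congˡ (δ-probe-≢ (toℕ i) (toℕ j) (i≢j ∘ FinP.toℕ-injective))) (zeroʳ _))) ⟩
    ∑ A n (λ i → a i * δ (toℕ i) (probe (toℕ j)))
      ≈⟨ ∑≈0 (probe (toℕ j)) ⟩
    0# ∎)

theorem5p3 : ∀ {c ℓ : Level} (A : QAlgebra c ℓ) → Nonzero A → InfiniteDimensional A
theorem5p3 A _ n = δ∈𝔱 ∘ toℕ , δ-linearlyIndependent n
  where open Derivations A
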